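{- Let $G$ be a graph with rooted branch decomposition $(T,\delta)$, let $k\ge1$, and let $t$ be a node of $T$ with exactly two children $r$ and $s$. Let $\gamma_t$ be a $t$-signature, $\gamma_r$ an $r$-signature and $\gamma_s$ an $s$-signature such that $(\gamma_t,\gamma_r,\gamma_s)$ is compatible, there is a valid partial $b$-coloring of $G_r$ with $r$-signature $\gamma_r$, and there is a valid partial $b$-coloring of $G_s$ with $s$-signature $\gamma_s$. Then there is a valid partial $b$-coloring of $G_t$ with $t$-signature $\gamma_t$.
   Context: Graphs are finite and simple; $k$ is a fixed number of colors. A rooted branch decomposition of $G$ is a pair $(T,\delta)$ with $T$ a rooted tree of maximum degree at most $3$ and $\delta$ a bijection from $V(G)$ to the leaves of $T$. For a node $t$: $V_t$ is the set of vertices mapped to leaves of the subtree rooted at $t$, $\overline{V_t}=V(G)\setminus V_t$, $G_t=G[V_t]$, and $\sim_t$ is the equivalence relation on $V_t$ with $u\sim_t v$ iff $N_G(u)\cap\overline{V_t}=N_G(v)\cap\overline{V_t}$. Operator: if $t$ has children $r,s$, $H_t$ is the bipartite graph on $V_r/{\sim_r}\cup V_s/{\sim_s}$ with $Q_rQ_s\in E(H_t)$ iff $G$ has an edge between $Q_r$ and $Q_s$; for $p\in\{r,s\}$, $\pi_p:V_p/{\sim_p}\to V_t/{\sim_t}$ maps a class to the class of $\sim_t$ containing it. A partial $b$-coloring of $G_t$ is a pair $(\mathcal{C},B)$ with $\mathcal{C}=(C_1,\ldots,C_k)$ a proper coloring of $G_t$ (ordered partition of $V_t$ into $k$ possibly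 empty independent sets) and $B\subseteq V_t$ with $|C_i\cap B|\le1$ for all $i$. Type of a class $C=C_i$: the pair $(f,\beta)$ with $\beta=1$ iff $C\cap B\ne\emptyset$ (else $0$), and $f:V_t/{\sim_t}\to\{\mathrm{none},\mathrm{contains},\mathrm{demand}\}$: $f(Q)=\mathrm{contains}$ if $Q\cap C\ne\emptyset$; $f(Q)=\mathrm{demand}$ if $Q\cap C=\emptyset$ and some $v\in B\cap Q$ has $N_{G_t}(v)\cap C=\emptyset$; $\mathrm{none}$ otherwise. $\mathcal{T}_t$ is the set of all such pairs ($t$-types). $C$ is invalid if some $Q\in V_t/{\sim_t}$ with $Q\cap C\ne\emptyset$ contains a $v\in B$ with $N_{G_t}[v]\cap C=\emptyset$; $(\mathcal{C},B)$ is valid if all its classes are valid. Compatible types: $\rho=(f_r,\beta_r)\in\mathcal{T}_r$, $\sigma=(f_s,\beta_s)\in\mathcal{T}_s$ are compatible if (1) $\beta_r+\beta_s\le1$; (2) no $Q_rQ_s\in E(H_t)$ has $f_r(Q_r)=f_s(Q_s)=\mathrm{contains}$; (3) for every $Q\in V_t/{\sim_t}$ such that some $p\in\{r,s\}$ and $Q_p\in\pi_p^{ -1}(Q)$ have $f_p(Q_p)=\mathrm{contains}$: each $Q_r\in\pi_r^{ -1}(Q)$ with $f_r(Q_r)=\mathrm{demand}$ has an $H_t$-neighbor $Q_s$ with $f_s(Q_s)=\mathrm{contains}$, and symmetrically with $r,s$ swapped. Their merge type is $(f_t,\beta_r+\beta_s)\in\mathcal{T}_t$ where, writing $o$ for the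 element of $\{r,s\}\setminus\{p\}$: $f_t(Q)=\mathrm{contains}$ if some $p$ and $Q_p\in\pi_p^{ -1}(Q)$ have $f_p(Q_p)=\mathrm{contains}$; otherwise $f_t(Q)=\mathrm{demand}$ if some $p$ and $Q_p\in\pi_p^{ -1}(Q)$ have $f_p(Q_p)=\mathrm{demand}$ and every $Q_o$ with $Q_pQ_o\in E(H_t)$ has $f_o(Q_o)\ne\mathrm{contains}$; otherwise $f_t(Q)=\mathrm{none}$. Signatures: a $t$-signature is a map $\gamma:\mathcal{T}_t\to\{0,1,\ldots,k\}$ with $\sum_{\tau}\gamma(\tau)=k$; the $t$-signature of a partial $b$-coloring of $G_t$ maps each $\tau$ to the number of its colour classes of type $\tau$. Merge skeleton of $r,s$: the bipartite graph $M$ on $\mathcal{T}_r\cup\mathcal{T}_s$ with $\rho\sigma\in E(M)$ iff $\rho,\sigma$ are compatible, with edge labeling $\mu(\rho\sigma)=$ merge type of $\rho$ and $\sigma$. A triple $(\gamma_t,\gamma_r,\gamma_s)$ is compatible if there is $\lambda:E(M)\to\{0,1,\ldots,k\}$ such that for every $p\in\{r,s\}$ and $\pi\in\mathcal{T}_p$, $\sum_{e\ni\pi}\lambda(e)=\gamma_p(\pi)$, and for every $\tau\in\mathcal{T}_t$, $\sum_{e:\mu(e)=\tau}\lambda(e)=\gamma_t(\tau)$. -}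

module Defs where

open import Data.Bool using (Bool; true; false; _∧_; _∨_; not; _xor_; if_then_else_)
open import Data.Bool.Properties using () renaming (_≟_ to _≟B_)
open import Data.Nat using (ℕ; zero; suc; _+_; _≤_)
open import Data.Fin using (Fin)
open import Data.Fin.Properties using () renaming (_≟_ to _≟F_)
open import Data.List using (List; []; _∷_; _++_; length; allFin; map; concatMap; foldr)
open import Data.Bool.ListAction using (any; all)
open import Data.List.Membership.Propositional using (_∈_)
open import Data.List.Relation.Unary.All using (All)
open import Data.List.Relation.Unary.Unique.Propositional using (Unique)
open import Data.Vec using (Vec; lookup; tabulate) renaming ([] to []ᵥ; _∷_ to _∷ᵥ_)
import Data.Vec.Properties as VecP
open import Data.Product using (Σ; _×_; _,_; proj₁; proj₂)
open import Data.Sum using (_⊎_)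
open import Relation.Nullary using (¬_; Dec; yes; no)
open import Relation.Nullary.Decidable using (⌊_⌋)
open import Relation.Binary.PropositionalEquality using (_≡_; _≢_; refl; cong; cong₂)
open import Relation.Binary.Definitions using (DecidableEquality)

record Graph (n : ℕ) : Set where
  field
    adj        : Fin n → Fin n → Bool
    adj-sym    : ∀ u v → adj u v ≡ adj v u
    adj-irrefl : ∀ v → adj v v ≡ false

-- The labelling of the leaves is the map δ⁻¹; a node with no children is
-- a leaf, so internal nodes are required to have at least one child.

data RTree (n : ℕ) : Set where
  leaf : Fin n → RTree n
  node : List (RTree n) → RTree n

mutual
  -- the list of (labels of) leaves below a node, i.e. V_t as a list
  leaves : ∀ {n} → RTree n → List (Fin n)
  leaves (leaf v)  = v ∷ []
  leaves (node cs) = leavesL cs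

  leavesL : ∀ {n} → List (RTree n) → List (Fin n)
  leavesL []       = []
  leavesL (c ∷ cs) = leaves c ++ leavesL cs

-- t ≼ T : t is (the subtree rooted at) a node of T
data _≼_ {n : ℕ} (t : RTree n) : RTree n → Set where
  here  : t ≼ t
  there : ∀ {c cs} → t ≼ c → c ∈ cs → t ≼ node cs

-- DegBound b t : t has at most b children, every internal node has ≥ 1
-- child, and every proper descendant has at most 2 children (degree ≤ 3,
-- counting the edge to its parent).
data DegBound {n : ℕ} : ℕ → RTree n → Set where
  leafB : ∀ {b} v → DegBound b (leaf v)
  nodeB : ∀ {b cs} → 1 ≤ length cs → length cs ≤ b → All (DegBound 2) cs →
          DegBound b (node cs)

-- A rooted branch decomposition (T , δ) of a graph on Fin n:
-- T has maximum degree ≤ 3 and δ is a bijection V(G) → leaves(T),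
-- i.e. every vertex labels exactly one leaf.
record RootedBranchDecomposition (n : ℕ) : Set where
  field
    tree          : RTree n
    maxDegree≤3   : DegBound 3 tree
    leaves-unique : Unique (leaves tree)
    leaves-cover  : ∀ v → v ∈ leaves tree

memb : ∀ {n} → Fin n → List (Fin n) → Bool
memb v xs = any (λ u → ⌊ v ≟F u ⌋) xs

inV : ∀ {n} → RTree n → Fin n → Bool
inV t v = memb v (leaves t)

anyV : ∀ {n} → (Fin n → Bool) → Bool
anyV {n} p = any p (allFin n)

allV : ∀ {n} → (Fin n → Bool) → Bool
allV {n} p = all p (allFin n)

_⇒b_ : Bool → Bool → Bool
a ⇒b b = not a ∨ b

_==b_ : Bool → Bool → Bool
a ==b b = not (a xor b)

bit : Bool → ℕ
bit false = 0
bit true  = 1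

sumL : ∀ {A : Set} → (A → ℕ) → List A → ℕ
sumL f = foldr (λ x acc → f x + acc) 0

countF : ∀ {k} → (Fin k → Bool) → ℕ
countF {k} p = foldr (λ i acc → if p i then suc acc else acc) 0 (allFin k)

-- A function f : V_t/∼_t → Label is represented by a vector indexed by
-- all vertices of G that is constant on ∼_t-classes and equals `none`
-- outside V_t (a canonical representation, so that ≡ is equality of types).

data Label : Set where
  none contains demand : Label

_≟L_ : DecidableEquality Label
none     ≟L none     = yes refl
none     ≟L contains = no (λ ())
none     ≟L demand   = no (λ ())
contains ≟L none     = no (λ ())
contains ≟L contains = yes refl
contains ≟L demand   = no (λ ())
demand   ≟L none     = no (λ ())
demand   ≟L contains = no (λ ())
demand   ≟L demand   = yes refl

isContains : Label → Bool
isContains contains = true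
isContains _        = false

isDemand : Label → Bool
isDemand demand = true
isDemand _      = false

TypeRep : ℕ → Set
TypeRep n = Vec Label n × Bool

_≟T_ : ∀ {n} → DecidableEquality (TypeRep n)
(f , β) ≟T (g , γ) with VecP.≡-dec _≟L_ f g | β ≟B γ
... | yes refl | yes refl = yes refl
... | no f≢g   | _        = no (λ e → f≢g (cong proj₁ e))
... | yes _    | no β≢γ   = no (λ e → β≢γ (cong proj₂ e))

allVecs : ∀ m → List (Vec Label m)
allVecs zero    = []ᵥ ∷ []
allVecs (suc m) = concatMap (λ l → map (l ∷ᵥ_) (allVecs m)) (none ∷ contains ∷ demand ∷ [])

-- enumeration of all representations (a superset of every 𝒯_t)
allTypeReps : ∀ n → List (TypeRep n)
allTypeReps n = concatMap (λ f → (f , false) ∷ (f , true) ∷ []) (allVecs n)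

allTypePairs : ∀ n → List (TypeRep n × TypeRep n)
allTypePairs n = concatMap (λ ρ → map (ρ ,_) (allTypeReps n)) (allTypeReps n)

module _ {n : ℕ} (G : Graph n) where
  open Graph G

  -- u ∼_t v  (meaningful for u, v ∈ V_t):  N(u) ∩ V̄_t = N(v) ∩ V̄_t
  sim : RTree n → Fin n → Fin n → Bool
  sim t u v = allV (λ w → not (inV t w) ⇒b (adj u w ==b adj v w))

  IsTType : RTree n → TypeRep n → Set
  IsTType t (f , β) =
    (∀ v → inV t v ≡ false → lookup f v ≡ none) ×
    (∀ u v → inV t u ≡ true → inV t v ≡ true → sim t u v ≡ true →
       lookup f u ≡ lookup f v)

  -- Partial b-colorings of G_t with k colours.  The colouring
  -- 𝒞 = (C_1,…,C_k) is given by col, with C_i = {v ∈ V_t | col v = i}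
  -- (values of col outside V_t are irrelevant).
  record PartialBColoring (k : ℕ) (t : RTree n) : Set where
    field
      col    : Fin n → Fin k
      B      : Fin n → Bool
      proper : ∀ u v → inV t u ≡ true → inV t v ≡ true → adj u v ≡ true →
               col u ≢ col v
      B⊆V    : ∀ v → B v ≡ true → inV t v ≡ true
      B-once : ∀ u v → B u ≡ true → B v ≡ true → col u ≡ col v → u ≡ v

  module _ {k : ℕ} {t : RTree n} (c : PartialBColoring k t) where
    open PartialBColoring c

    inC : Fin k → Fin n → Bool
    inC i v = inV t v ∧ ⌊ col v ≟F i ⌋

    classMeets : Fin k → Fin n → Bool
    classMeets i v = anyV (λ u → inV t u ∧ sim t u v ∧ inC i u)

    typeOf : Fin k → TypeRep n
    typeOf i = tabulate lab , anyV (λ u → B u ∧ inC i u)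
      where
      lab : Fin n → Label
      lab v =
        if not (inV t v) then none
        else if classMeets i v then contains
        else if anyV (λ u → inV t u ∧ sim t u v ∧ B u ∧
                            allV (λ w → (inV t w ∧ adj u w) ⇒b not (inC i w)))
             then demand
        else none

    InvalidClass : Fin k → Set
    InvalidClass i =
      Σ (Fin n) λ v → inV t v ≡ true × B v ≡ true × classMeets i v ≡ true ×
        inC i v ≡ false × (∀ w → inC i w ≡ true → adj v w ≡ false)

    Valid : Set
    Valid = ∀ i → ¬ InvalidClass i

    HasSignature : (TypeRep n → ℕ) → Set
    HasSignature γ = ∀ τ → countF (λ i → ⌊ typeOf i ≟T τ ⌋) ≡ γ τ

  IsSignature : ℕ → RTree n → (TypeRep n → ℕ) → Set
  IsSignature k t γ =
    (∀ τ → ¬ IsTType t τ → γ τ ≡ 0) × sumL γ (allTypeReps n) ≡ k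

  -- Q_p Q_o ∈ E(H_t) where Q_p = [u]_{∼p}, Q_o = [w]_{∼o}
  HE : RTree n → RTree n → Fin n → Fin n → Bool
  HE p o u w = anyV (λ u' → anyV (λ w' →
    inV p u' ∧ sim p u' u ∧ inV o w' ∧ sim o w' w ∧ adj u' w'))

  module _ (t r s : RTree n) where

    containsIn : Vec Label n → Vec Label n → Fin n → Bool
    containsIn fr fs v =
      anyV (λ u → inV r u ∧ sim t u v ∧ isContains (lookup fr u)) ∨
      anyV (λ w → inV s w ∧ sim t w v ∧ isContains (lookup fs w))

    DemandsMet : RTree n → RTree n → Vec Label n → Vec Label n → Fin n → Set
    DemandsMet p o fp fo v =
      ∀ u → inV p u ≡ true → sim t u v ≡ true → lookup fp u ≡ demand →
        Σ (Fin n) λ w → inV o w ≡ true × HE p o u w ≡ true × lookup fo w ≡ contains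

    Compatible : TypeRep n → TypeRep n → Set
    Compatible (fr , βr) (fs , βs) =
      (bit βr + bit βs ≤ 1) ×
      (∀ u w → inV r u ≡ true → inV s w ≡ true → HE r s u w ≡ true →
         lookup fr u ≡ contains → lookup fs w ≢ contains) ×
      (∀ v → inV t v ≡ true → containsIn fr fs v ≡ true →
         DemandsMet r s fr fs v × DemandsMet s r fs fr v)

    demandSide : RTree n → RTree n → Vec Label n → Vec Label n → Fin n → Bool
    demandSide p o fp fo v =
      anyV (λ u → inV p u ∧ sim t u v ∧ isDemand (lookup fp u) ∧
        allV (λ w → (inV o w ∧ HE p o u w) ⇒b not (isContains (lookup fo w))))

    -- merge type (β_r + β_s is written as β_r ∨ β_s; on compatible
    -- pairs β_r + β_s ≤ 1 so these agree)
    mergeType : TypeRep n → TypeRep n → TypeRep n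
    mergeType (fr , βr) (fs , βs) = tabulate lab , (βr ∨ βs)
      where
      lab : Fin n → Label
      lab v =
        if not (inV t v) then none
        else if containsIn fr fs v then contains
        else if demandSide r s fr fs v ∨ demandSide s r fs fr v then demand
        else none

    -- (γ_t , γ_r , γ_s) is compatible: there is λ : E(M) → {0,…,k}
    -- (represented as a function on all pairs that vanishes off E(M))
    -- with the prescribed marginals.
    CompatibleTriple : ℕ → (γt γr γs : TypeRep n → ℕ) → Set
    CompatibleTriple k γt γr γs =
      Σ (TypeRep n → TypeRep n → ℕ) λ lam →
        (∀ ρ σ → lam ρ σ ≢ 0 → IsTType r ρ × IsTType s σ × Compatible ρ σ) ×
        (∀ ρ σ → lam ρ σ ≤ k) ×
        (∀ ρ → IsTType r ρ → sumL (λ σ → lam ρ σ) (allTypeReps n) ≡ γr ρ) ×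
        (∀ σ → IsTType s σ → sumL (λ ρ → lam ρ σ) (allTypeReps n) ≡ γs σ) ×
        (∀ τ → IsTType t τ →
           sumL (λ ρσ → if ⌊ mergeType (proj₁ ρσ) (proj₂ ρσ) ≟T τ ⌋
                        then lam (proj₁ ρσ) (proj₂ ρσ) else 0)
                (allTypePairs n) ≡ γt τ)

module Submission where

-- The compatible triple provides a weight λ on compatible pairs (ρ , σ) with
-- marginals γr, γs and merge push-forward γt.  Expanding λ into a list of k
-- pairs, the colour classes of c_r and c_s have the multiplicities of its first
-- and second components, so the alignment lemma yields permutations πr, πs with
-- class πr(m) of c_r of type ρ_m and class πs(m) of c_s of type σ_m.  Joining
-- these classes colours V_t = V_r ⊎ V_s properly, with B used once per class, by
-- compatibility (2) and (1); comparing labels shows that class m has type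
-- mergeType ρ_m σ_m, and compatibility (3) with validity of c_r, c_s gives
-- validity.  Counting types then yields the signature γt.

open import Defs
open import Data.Nat using (ℕ; zero; suc; _+_; _*_; _≤_; s≤s)
import Data.Nat as ℕ
open import Data.Nat.Properties using (+-cancelˡ-≡; +-identityʳ; +-assoc; +-comm)
open import Data.Bool using (Bool; true; false; _∧_; _∨_; not; if_then_else_)
open import Data.Bool.Properties using (∨-identityʳ) renaming (_≟_ to _≟B_)
open import Data.Fin using (Fin; zero; suc; punchIn)
open import Data.Fin.Properties using (all?) renaming (_≟_ to _≟F_)
open import Data.Fin.Permutation
  using (Permutation; _⟨$⟩ʳ_; _⟨$⟩ˡ_; inverseˡ; inverseʳ; insert; insert-punchIn)
  renaming (id to idₚ)
open import Data.List using (List; []; _∷_; _++_; allFin; map; concatMap; foldr; replicate)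
import Data.List as List
open import Data.Bool.ListAction using (any; all)
open import Data.List.Membership.Propositional using (_∈_)
open import Data.List.Membership.Propositional.Properties using (∈-allFin; ∈-++⁺ˡ; ∈-++⁺ʳ; ∈-++⁻)
open import Data.List.Relation.Unary.Any using (here; there)
open import Data.List.Relation.Unary.All using (All; []; _∷_) renaming (lookup to lookupAll)
open import Data.List.Relation.Unary.All.Properties using (++⁺)
open import Data.List.Relation.Unary.AllPairs using ([]; _∷_)
open import Data.List.Relation.Unary.Unique.Propositional using (Unique)
open import Data.Vec using (Vec; lookup; tabulate) renaming ([] to []ᵥ; _∷_ to _∷ᵥ_)
import Data.Vec.Properties as Vecₚ
open import Data.Product using (Σ; _×_; _,_; proj₁; proj₂)
open import Data.Sum using (_⊎_; inj₁; inj₂; [_,_]′)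
open import Data.Empty using (⊥; ⊥-elim)
open import Relation.Nullary using (¬_; Dec; yes; no)
open import Relation.Nullary.Decidable using (⌊_⌋; _×-dec_; _→-dec_)
open import Relation.Binary.Definitions using (DecidableEquality)
open import Relation.Binary.PropositionalEquality
  using (_≡_; _≢_; refl; sym; trans; cong; cong₂; subst; subst₂)

bool-ext : ∀ {a b : Bool} → (a ≡ true → b ≡ true) → (b ≡ true → a ≡ true) → a ≡ b
bool-ext {false} {false} _ _ = refl
bool-ext {false} {true}  _ g = g refl
bool-ext {true}  {false} f _ = sym (f refl)
bool-ext {true}  {true}  _ _ = refl

∧-true⁻ : ∀ {a b} → a ∧ b ≡ true → a ≡ true × b ≡ true
∧-true⁻ {true} {true} _ = refl , refl

∧-true⁺ : ∀ {a b} → a ≡ true → b ≡ true → a ∧ b ≡ true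
∧-true⁺ refl refl = refl

∨-true⁻ : ∀ {a b} → a ∨ b ≡ true → a ≡ true ⊎ b ≡ true
∨-true⁻ {true}  _ = inj₁ refl
∨-true⁻ {false} e = inj₂ e

∨-trueˡ : ∀ {a b} → a ≡ true → a ∨ b ≡ true
∨-trueˡ refl = refl

∨-trueʳ : ∀ {a b} → b ≡ true → a ∨ b ≡ true
∨-trueʳ {true}  _ = refl
∨-trueʳ {false} e = e

not-true⁻ : ∀ {a} → not a ≡ true → a ≡ false
not-true⁻ {false} _ = refl

not-true⁺ : ∀ {a} → a ≡ false → not a ≡ true
not-true⁺ refl = refl

true≢false : ∀ {a} → a ≡ true → a ≡ false → ⊥
true≢false refl ()

¬true⇒false : ∀ {a} → ¬ (a ≡ true) → a ≡ false
¬true⇒false {false} _ = refl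
¬true⇒false {true}  h = ⊥-elim (h refl)

⇒b-true⁻ : ∀ {a b} → a ⇒b b ≡ true → a ≡ true → b ≡ true
⇒b-true⁻ {true} e refl = e

⇒b-true⁺ : ∀ {a b} → (a ≡ true → b ≡ true) → a ⇒b b ≡ true
⇒b-true⁺ {false} _ = refl
⇒b-true⁺ {true}  f = f refl

==b-true⁻ : ∀ {a b} → a ==b b ≡ true → a ≡ b
==b-true⁻ {false} {false} _ = refl
==b-true⁻ {true}  {true}  _ = refl

==b-true⁺ : ∀ {a b} → a ≡ b → a ==b b ≡ true
==b-true⁺ {false} refl = refl
==b-true⁺ {true}  refl = refl

does-true⁻ : ∀ {A : Set} {x y : A} (d : Dec (x ≡ y)) → ⌊ d ⌋ ≡ true → x ≡ y
does-true⁻ (yes p) _ = p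

does-true⁺ : ∀ {A : Set} {x y : A} (d : Dec (x ≡ y)) → x ≡ y → ⌊ d ⌋ ≡ true
does-true⁺ (yes _) _ = refl
does-true⁺ (no ¬p) p = ⊥-elim (¬p p)

does-false⁺ : ∀ {A : Set} {x y : A} (d : Dec (x ≡ y)) → x ≢ y → ⌊ d ⌋ ≡ false
does-false⁺ (yes p) ¬p = ⊥-elim (¬p p)
does-false⁺ (no _)  _  = refl

if-true : ∀ {A : Set} {b} {x y : A} → b ≡ true → (if b then x else y) ≡ x
if-true refl = refl

if-false : ∀ {A : Set} {b} {x y : A} → b ≡ false → (if b then x else y) ≡ y
if-false refl = refl

any-true⁺ : ∀ {A : Set} (p : A → Bool) {x} xs → x ∈ xs → p x ≡ true → any p xs ≡ true
any-true⁺ p (_ ∷ _)  (here refl) e = ∨-trueˡ e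
any-true⁺ p (_ ∷ xs) (there x∈)  e = ∨-trueʳ (any-true⁺ p xs x∈ e)

any-true⁻ : ∀ {A : Set} (p : A → Bool) xs → any p xs ≡ true → Σ A λ x → p x ≡ true
any-true⁻ p (y ∷ xs) e with ∨-true⁻ {p y} e
... | inj₁ py = y , py
... | inj₂ h  = any-true⁻ p xs h

all-true⁺ : ∀ {A : Set} (p : A → Bool) xs → (∀ x → p x ≡ true) → all p xs ≡ true
all-true⁺ p []       _ = refl
all-true⁺ p (y ∷ xs) f = ∧-true⁺ (f y) (all-true⁺ p xs f)

all-true⁻ : ∀ {A : Set} (p : A → Bool) {x} xs → all p xs ≡ true → x ∈ xs → p x ≡ true
all-true⁻ p (y ∷ _)  e (here refl) = proj₁ (∧-true⁻ {p y} e)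
all-true⁻ p (y ∷ xs) e (there x∈)  = all-true⁻ p xs (proj₂ (∧-true⁻ {p y} e)) x∈

anyV-true⁺ : ∀ {n} (p : Fin n → Bool) x → p x ≡ true → anyV p ≡ true
anyV-true⁺ {n} p x = any-true⁺ p (allFin n) (∈-allFin x)

anyV-true⁻ : ∀ {n} (p : Fin n → Bool) → anyV p ≡ true → Σ (Fin n) λ x → p x ≡ true
anyV-true⁻ {n} p = any-true⁻ p (allFin n)

allV-true⁺ : ∀ {n} (p : Fin n → Bool) → (∀ x → p x ≡ true) → allV p ≡ true
allV-true⁺ {n} p = all-true⁺ p (allFin n)

allV-true⁻ : ∀ {n} (p : Fin n → Bool) → allV p ≡ true → ∀ x → p x ≡ true
allV-true⁻ {n} p e x = all-true⁻ p (allFin n) e (∈-allFin x)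

anyV-cong : ∀ {n} {f g : Fin n → Bool} → (∀ x → f x ≡ g x) → anyV f ≡ anyV g
anyV-cong {f = f} {g} f≗g = bool-ext
  (λ e → let (x , fx) = anyV-true⁻ f e in anyV-true⁺ g x (trans (sym (f≗g x)) fx))
  (λ e → let (x , gx) = anyV-true⁻ g e in anyV-true⁺ f x (trans (f≗g x) gx))

memb-true⁺ : ∀ {n} (v : Fin n) xs → v ∈ xs → memb v xs ≡ true
memb-true⁺ v xs v∈ = any-true⁺ (λ u → ⌊ v ≟F u ⌋) xs v∈ (does-true⁺ (v ≟F v) refl)

memb-true⁻ : ∀ {n} (v : Fin n) xs → memb v xs ≡ true → v ∈ xs
memb-true⁻ v (y ∷ xs) e with v ≟F y
... | yes refl = here refl
... | no _     = there (memb-true⁻ v xs e)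

memb-++ : ∀ {n} (v : Fin n) xs ys → memb v (xs ++ ys) ≡ memb v xs ∨ memb v ys
memb-++ v xs ys = bool-ext
  (λ e → [ (λ v∈ → ∨-trueˡ (memb-true⁺ v xs v∈))
         , (λ v∈ → ∨-trueʳ {memb v xs} (memb-true⁺ v ys v∈)) ]′
         (∈-++⁻ xs (memb-true⁻ v (xs ++ ys) e)))
  (λ e → [ (λ h → memb-true⁺ v (xs ++ ys) (∈-++⁺ˡ (memb-true⁻ v xs h)))
         , (λ h → memb-true⁺ v (xs ++ ys) (∈-++⁺ʳ xs (memb-true⁻ v ys h))) ]′ (∨-true⁻ e))

unique-++ˡ : ∀ {A : Set} (xs ys : List A) → Unique (xs ++ ys) → Unique xs
unique-++ˡ []       ys _         = []
unique-++ˡ (x ∷ xs) ys (x∉ ∷ u) = prefix xs x∉ ∷ unique-++ˡ xs ys u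
  where
  prefix : ∀ {A : Set} {P : A → Set} (zs : List A) {ws} → All P (zs ++ ws) → All P zs
  prefix []       _        = []
  prefix (z ∷ zs) (p ∷ ps) = p ∷ prefix zs ps

unique-++ʳ : ∀ {A : Set} (xs ys : List A) → Unique (xs ++ ys) → Unique ys
unique-++ʳ []       ys u       = u
unique-++ʳ (x ∷ xs) ys (_ ∷ u) = unique-++ʳ xs ys u

unique-++-disjoint : ∀ {A : Set} (xs ys : List A) → Unique (xs ++ ys) →
  ∀ {v} → v ∈ xs → v ∈ ys → ⊥
unique-++-disjoint (x ∷ xs) ys (x∉ ∷ _) (here refl) v∈ys = lookupAll x∉ (∈-++⁺ʳ xs v∈ys) refl
unique-++-disjoint (x ∷ xs) ys (_ ∷ u)  (there v∈xs) v∈ys = unique-++-disjoint xs ys u v∈xs v∈ys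

unique-child : ∀ {n} {c : RTree n} {cs} → c ∈ cs → Unique (leavesL cs) → Unique (leaves c)
unique-child {c = c} {_ ∷ cs}  (here refl) u = unique-++ˡ (leaves c) (leavesL cs) u
unique-child {cs = c' ∷ cs} (there c∈)  u = unique-child c∈ (unique-++ʳ (leaves c') (leavesL cs) u)

unique-subtree : ∀ {n} {t T : RTree n} → t ≼ T → Unique (leaves T) → Unique (leaves t)
unique-subtree here             u = u
unique-subtree (there t≼c c∈cs) u = unique-subtree t≼c (unique-child c∈cs u)

inV-binary : ∀ {n} (r s : RTree n) v → inV (node (r ∷ s ∷ [])) v ≡ inV r v ∨ inV s v
inV-binary r s v = trans (memb-++ v (leaves r) (leaves s ++ []))
  (cong (inV r v ∨_) (trans (memb-++ v (leaves s) []) (∨-identityʳ _)))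

children-disjoint : ∀ {n} (r s : RTree n) → Unique (leaves (node (r ∷ s ∷ []))) →
  ∀ v → inV r v ≡ true → inV s v ≡ false
children-disjoint r s u v v∈r = ¬true⇒false λ v∈s →
  unique-++-disjoint (leaves r) (leaves s ++ []) u (memb-true⁻ v (leaves r) v∈r)
    (∈-++⁺ˡ (memb-true⁻ v (leaves s) v∈s))

cnt : ∀ {k} → (Fin k → Bool) → ℕ
cnt {zero}  p = 0
cnt {suc k} p = bit (p zero) + cnt (λ i → p (suc i))

cntL : ∀ {A : Set} → (A → Bool) → List A → ℕ
cntL p []       = 0
cntL p (x ∷ xs) = bit (p x) + cntL p xs

countF≡cnt : ∀ {k} (p : Fin k → Bool) → countF p ≡ cnt p
countF≡cnt p = fold-tabulate p (λ i → i)
  where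
  fold-tabulate : ∀ {k k'} (p : Fin k' → Bool) (g : Fin k → Fin k') →
    foldr (λ i acc → if p i then suc acc else acc) 0 (List.tabulate g) ≡ cnt (λ i → p (g i))
  fold-tabulate {zero}  p g = refl
  fold-tabulate {suc k} p g with p (g zero)
  ... | true  = cong suc (fold-tabulate p (λ i → g (suc i)))
  ... | false = fold-tabulate p (λ i → g (suc i))

cnt-cong : ∀ {k} {f g : Fin k → Bool} → (∀ i → f i ≡ g i) → cnt f ≡ cnt g
cnt-cong {zero}  _   = refl
cnt-cong {suc k} f≗g = cong₂ _+_ (cong bit (f≗g zero)) (cnt-cong (λ i → f≗g (suc i)))

cnt-false : ∀ {k} → cnt {k} (λ _ → false) ≡ 0
cnt-false {zero}  = refl
cnt-false {suc k} = cnt-false {k}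

cnt-punchIn : ∀ {k} (p : Fin (suc k) → Bool) i → cnt p ≡ bit (p i) + cnt (λ j → p (punchIn i j))
cnt-punchIn p zero = refl
cnt-punchIn {suc k} p (suc i) =
  trans (cong (bit (p zero) +_) (cnt-punchIn (λ j → p (suc j)) i)) (swap (bit (p zero)) (bit (p (suc i))) _)
  where
  swap : ∀ a b c → a + (b + c) ≡ b + (a + c)
  swap a b c = trans (sym (+-assoc a b c)) (trans (cong (_+ c) (+-comm a b)) (+-assoc b a c))

cnt-witness : ∀ {k} (p : Fin k → Bool) {c} → cnt p ≡ suc c → Σ (Fin k) λ i → p i ≡ true
cnt-witness {suc k} p e with p zero in p0
... | true  = zero , p0
... | false = let (i , pi) = cnt-witness (λ i → p (suc i)) e in suc i , pi

-- If two families fr, fs : Fin k → A have, value by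
-- value, the multiplicities of the first resp. second components of a list
-- X of pairs, then after permuting each family its m-th entries are the
-- components of the m-th pair of an enumeration of X.

module Alignment {A : Set} (_≟_ : DecidableEquality A) where

  mult : ∀ {k} → (Fin k → A) → A → ℕ
  mult f a = cnt (λ i → ⌊ f i ≟ a ⌋)

  Balanced : (A × A → A) → List (A × A) → ∀ {k} → (Fin k → A) → Set
  Balanced π X f = ∀ a → mult f a ≡ cntL (λ x → ⌊ π x ≟ a ⌋) X

  bit-≟-self : ∀ a → bit ⌊ a ≟ a ⌋ ≡ 1
  bit-≟-self a = cong bit (does-true⁺ (a ≟ a) refl)

  balanced-[] : ∀ {π k} (f : Fin (suc k) → A) → ¬ Balanced π [] f
  balanced-[] f bal with bal (f zero)
  ... | e rewrite bit-≟-self (f zero) = 0≢suc (sym e)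
    where 0≢suc : ∀ {c} → 0 ≢ suc c
          0≢suc ()

  balanced-zero : ∀ {π x X} (f : Fin 0 → A) → ¬ Balanced π (x ∷ X) f
  balanced-zero {π} {x} f bal with bal (π x)
  ... | e rewrite bit-≟-self (π x) = 0≢suc e
    where 0≢suc : ∀ {c} → 0 ≢ suc c
          0≢suc ()

  balanced-head : ∀ {π x X k} (f : Fin k → A) → Balanced π (x ∷ X) f →
    Σ (Fin k) λ i → f i ≡ π x
  balanced-head {π} {x} {X} f bal =
    let (i , fi) = cnt-witness (λ i → ⌊ f i ≟ π x ⌋)
                     (trans (bal (π x)) (cong (_+ cntL (λ y → ⌊ π y ≟ π x ⌋) X) (bit-≟-self (π x))))
    in i , does-true⁻ (f i ≟ π x) fi

  balanced-tail : ∀ {π x X k} (f : Fin (suc k) → A) i → f i ≡ π x →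
    Balanced π (x ∷ X) f → Balanced π X (λ j → f (punchIn i j))
  balanced-tail {π} {x} f i fi bal a = +-cancelˡ-≡ (bit ⌊ π x ≟ a ⌋) _ _
    (trans (cong (λ z → bit ⌊ z ≟ a ⌋ + mult (λ j → f (punchIn i j)) a) (sym fi))
      (trans (sym (cnt-punchIn (λ j → ⌊ f j ≟ a ⌋) i)) (bal a)))

  record Aligned (X : List (A × A)) {k} (fr fs : Fin k → A) : Set₁ where
    field
      pair      : Fin k → A × A
      πr πs     : Permutation k k
      alignedʳ  : ∀ m → fr (πr ⟨$⟩ʳ m) ≡ proj₁ (pair m)
      alignedˢ  : ∀ m → fs (πs ⟨$⟩ʳ m) ≡ proj₂ (pair m)
      pair-all  : ∀ {P : A × A → Set} → All P X → ∀ m → P (pair m)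
      pair-cnt  : ∀ (Q : A × A → Bool) → cnt (λ m → Q (pair m)) ≡ cntL Q X

  -- proof by induction on X: match the head pair, remove one occurrence on each side
  align : ∀ X {k} (fr fs : Fin k → A) →
    Balanced proj₁ X fr → Balanced proj₂ X fs → Aligned X fr fs
  align []      {zero}  fr fs _ _ = record
    { pair = λ () ; πr = idₚ ; πs = idₚ ; alignedʳ = λ () ; alignedˢ = λ ()
    ; pair-all = λ _ () ; pair-cnt = λ _ → refl }
  align []      {suc k} fr fs br _ = ⊥-elim (balanced-[] {proj₁} fr br)
  align (x ∷ X) {zero}  fr fs br _ = ⊥-elim (balanced-zero {proj₁} {x} {X} fr br)
  align (x ∷ X) {suc k} fr fs br bs = record
    { pair     = pair
    ; πr       = insert zero i πr′
    ; πs       = insert zero j πs′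
    ; alignedʳ = alignedʳ
    ; alignedˢ = alignedˢ
    ; pair-all = pair-all
    ; pair-cnt = λ Q → cong (bit (Q x) +_) (pair-cnt′ Q) }
    where
    headʳ : Σ (Fin (suc k)) λ i → fr i ≡ proj₁ x
    headʳ = balanced-head {proj₁} {x} {X} fr br
    headˢ : Σ (Fin (suc k)) λ j → fs j ≡ proj₂ x
    headˢ = balanced-head {proj₂} {x} {X} fs bs
    i = proj₁ headʳ
    j = proj₁ headˢ
    fri = proj₂ headʳ
    fsj = proj₂ headˢ
    open Aligned (align X (λ m → fr (punchIn i m)) (λ m → fs (punchIn j m))
                   (balanced-tail {proj₁} {x} {X} fr i fri br)
                   (balanced-tail {proj₂} {x} {X} fs j fsj bs))
      renaming (pair to pair′; πr to πr′; πs to πs′; alignedʳ to alignedʳ′; alignedˢ to alignedˢ′;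
                pair-all to pair-all′; pair-cnt to pair-cnt′)
    pair : Fin (suc k) → A × A
    pair zero    = x
    pair (suc m) = pair′ m
    alignedʳ : ∀ m → fr (insert zero i πr′ ⟨$⟩ʳ m) ≡ proj₁ (pair m)
    alignedʳ zero    = fri
    alignedʳ (suc m) = trans (cong fr (insert-punchIn zero i πr′ m)) (alignedʳ′ m)
    alignedˢ : ∀ m → fs (insert zero j πs′ ⟨$⟩ʳ m) ≡ proj₂ (pair m)
    alignedˢ zero    = fsj
    alignedˢ (suc m) = trans (cong fs (insert-punchIn zero j πs′ m)) (alignedˢ′ m)
    pair-all : ∀ {P : A × A → Set} → All P (x ∷ X) → ∀ m → P (pair m)
    pair-all (p ∷ _)  zero    = p
    pair-all (_ ∷ ps) (suc m) = pair-all′ ps m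

sumL-++ : ∀ {A : Set} (f : A → ℕ) xs ys → sumL f (xs ++ ys) ≡ sumL f xs + sumL f ys
sumL-++ f []       ys = refl
sumL-++ f (x ∷ xs) ys = trans (cong (f x +_) (sumL-++ f xs ys)) (sym (+-assoc (f x) _ _))

cntL-++ : ∀ {A : Set} (Q : A → Bool) xs ys → cntL Q (xs ++ ys) ≡ cntL Q xs + cntL Q ys
cntL-++ Q []       ys = refl
cntL-++ Q (x ∷ xs) ys = trans (cong (bit (Q x) +_) (cntL-++ Q xs ys)) (sym (+-assoc (bit (Q x)) _ _))

sumL-concatMap : ∀ {A B : Set} (f : B → ℕ) (g : A → List B) L →
  sumL f (concatMap g L) ≡ sumL (λ x → sumL f (g x)) L
sumL-concatMap f g []      = refl
sumL-concatMap f g (x ∷ L) =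
  trans (sumL-++ f (g x) (concatMap g L)) (cong (sumL f (g x) +_) (sumL-concatMap f g L))

cntL-concatMap : ∀ {A B : Set} (Q : B → Bool) (g : A → List B) L →
  cntL Q (concatMap g L) ≡ sumL (λ x → cntL Q (g x)) L
cntL-concatMap Q g []      = refl
cntL-concatMap Q g (x ∷ L) =
  trans (cntL-++ Q (g x) (concatMap g L)) (cong (cntL Q (g x) +_) (cntL-concatMap Q g L))

sumL-map : ∀ {A B : Set} (f : B → ℕ) (h : A → B) L → sumL f (map h L) ≡ sumL (λ x → f (h x)) L
sumL-map f h []      = refl
sumL-map f h (x ∷ L) = cong (f (h x) +_) (sumL-map f h L)

cntL-map : ∀ {A B : Set} (Q : B → Bool) (h : A → B) L → cntL Q (map h L) ≡ cntL (λ x → Q (h x)) L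
cntL-map Q h []      = refl
cntL-map Q h (x ∷ L) = cong (bit (Q (h x)) +_) (cntL-map Q h L)

sumL-cong : ∀ {A : Set} {f g : A → ℕ} L → (∀ x → f x ≡ g x) → sumL f L ≡ sumL g L
sumL-cong []      _   = refl
sumL-cong (x ∷ L) f≗g = cong₂ _+_ (f≗g x) (sumL-cong L f≗g)

cntL-cong : ∀ {A : Set} {f g : A → Bool} L → (∀ x → f x ≡ g x) → cntL f L ≡ cntL g L
cntL-cong []      _   = refl
cntL-cong (x ∷ L) f≗g = cong₂ _+_ (cong bit (f≗g x)) (cntL-cong L f≗g)

sumL-zero : ∀ {A : Set} L → sumL {A} (λ _ → 0) L ≡ 0
sumL-zero []      = refl
sumL-zero (_ ∷ L) = sumL-zero L

sumL-bit : ∀ {A : Set} (Q : A → Bool) L → sumL (λ x → bit (Q x)) L ≡ cntL Q L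
sumL-bit Q []      = refl
sumL-bit Q (x ∷ L) = cong (bit (Q x) +_) (sumL-bit Q L)

sumL-if : ∀ {A : Set} (b : Bool) (g : A → ℕ) L → sumL (λ x → if b then g x else 0) L ≡ (if b then sumL g L else 0)
sumL-if true  g L = refl
sumL-if false g L = sumL-zero L

cntL-∧ : ∀ {A : Set} (b : Bool) (Q : A → Bool) L → cntL (λ x → b ∧ Q x) L ≡ (if b then cntL Q L else 0)
cntL-∧ true  Q L       = refl
cntL-∧ false Q []      = refl
cntL-∧ false Q (_ ∷ L) = cntL-∧ false Q L

cntL-replicate : ∀ {A : Set} (Q : A → Bool) m p → cntL Q (replicate m p) ≡ (if Q p then m else 0)
cntL-replicate Q m p = go m (Q p) refl
  where
  go : ∀ m b → Q p ≡ b → cntL Q (replicate m p) ≡ (if b then m else 0)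
  go zero    true  _ = refl
  go zero    false _ = refl
  go (suc m) true  e rewrite e = cong suc (go m true e)
  go (suc m) false e rewrite e = go m false e

expand : ∀ {A : Set} → (A → ℕ) → List A → List A
expand w L = concatMap (λ p → replicate (w p) p) L

cntL-expand : ∀ {A : Set} (Q : A → Bool) (w : A → ℕ) L →
  cntL Q (expand w L) ≡ sumL (λ p → if Q p then w p else 0) L
cntL-expand Q w L = trans (cntL-concatMap Q (λ p → replicate (w p) p) L)
                          (sumL-cong L (λ p → cntL-replicate Q (w p) p))

All-expand : ∀ {A : Set} {P : A → Set} (w : A → ℕ) L → (∀ p → w p ≢ 0 → P p) → All P (expand w L)
All-expand w []      _      = []
All-expand w (x ∷ L) Psupp = ++⁺ (All-replicate (w x) (Psupp x)) (All-expand w L Psupp)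
  where
  All-replicate : ∀ {A : Set} {P : A → Set} {p : A} m → (m ≢ 0 → P p) → All P (replicate m p)
  All-replicate zero    _  = []
  All-replicate (suc m) Pp = Pp (λ ()) ∷ All-replicate m (λ _ → Pp (λ ()))

sumL-select : ∀ {A : Set} (_≟_ : DecidableEquality A) a (g : A → ℕ) L → cntL (λ x → ⌊ x ≟ a ⌋) L ≡ 1 →
  sumL (λ x → if ⌊ x ≟ a ⌋ then g x else 0) L ≡ g a
sumL-select _≟_ a g L once = trans (select L) (trans (cong (_* g a) once) (+-identityʳ (g a)))
  where
  select : ∀ L → sumL (λ x → if ⌊ x ≟ a ⌋ then g x else 0) L ≡ cntL (λ x → ⌊ x ≟ a ⌋) L * g a
  select []      = refl
  select (x ∷ L) with x ≟ a
  ... | yes refl = cong (g x +_) (select L)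
  ... | no _     = select L

_≟V_ : ∀ {m} → DecidableEquality (Vec Label m)
_≟V_ = Vecₚ.≡-dec _≟L_

≟V-∷ : ∀ {m} l (v : Vec Label m) l₀ v₀ → ⌊ (l ∷ᵥ v) ≟V (l₀ ∷ᵥ v₀) ⌋ ≡ ⌊ l ≟L l₀ ⌋ ∧ ⌊ v ≟V v₀ ⌋
≟V-∷ l v l₀ v₀ = bool-ext
  (λ e → split (does-true⁻ ((l ∷ᵥ v) ≟V (l₀ ∷ᵥ v₀)) e))
  (λ e → let (l≡ , v≡) = ∧-true⁻ {⌊ l ≟L l₀ ⌋} e in
     does-true⁺ ((l ∷ᵥ v) ≟V (l₀ ∷ᵥ v₀)) (cong₂ _∷ᵥ_ (does-true⁻ (l ≟L l₀) l≡) (does-true⁻ (v ≟V v₀) v≡)))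
  where
  split : l ∷ᵥ v ≡ l₀ ∷ᵥ v₀ → ⌊ l ≟L l₀ ⌋ ∧ ⌊ v ≟V v₀ ⌋ ≡ true
  split refl = ∧-true⁺ (does-true⁺ (l ≟L l) refl) (does-true⁺ (v ≟V v) refl)

allVecs-once : ∀ m (v₀ : Vec Label m) → cntL (λ v → ⌊ v ≟V v₀ ⌋) (allVecs m) ≡ 1
allVecs-once zero    []ᵥ         = refl
allVecs-once (suc m) (l₀ ∷ᵥ v₀) =
  trans (cntL-concatMap is-target (λ l → map (l ∷ᵥ_) (allVecs m)) labels)
    (trans (sumL-cong labels (λ l →
              trans (cntL-map is-target (l ∷ᵥ_) (allVecs m))
                (trans (cntL-cong (allVecs m) (λ v → ≟V-∷ l v l₀ v₀))
                       (cntL-∧ ⌊ l ≟L l₀ ⌋ (λ v → ⌊ v ≟V v₀ ⌋) (allVecs m)))))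
           (one-label l₀))
  where
  labels = none ∷ contains ∷ demand ∷ []
  is-target : Vec Label (suc m) → Bool
  is-target v = ⌊ v ≟V (l₀ ∷ᵥ v₀) ⌋
  one-label : ∀ l₀ → sumL (λ l → if ⌊ l ≟L l₀ ⌋ then cntL (λ v → ⌊ v ≟V v₀ ⌋) (allVecs m) else 0) labels ≡ 1
  one-label none     rewrite allVecs-once m v₀ = refl
  one-label contains rewrite allVecs-once m v₀ = refl
  one-label demand   rewrite allVecs-once m v₀ = refl

allTypeReps-once : ∀ n (τ : TypeRep n) → cntL (λ ρ → ⌊ ρ ≟T τ ⌋) (allTypeReps n) ≡ 1
allTypeReps-once n (f₀ , β₀) =
  trans (cntL-concatMap _ (λ f → (f , false) ∷ (f , true) ∷ []) (allVecs n))
    (trans (sumL-cong (allVecs n) (λ f → both-flags β₀ (f ≟V f₀)))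
      (trans (sumL-bit _ (allVecs n)) (allVecs-once n f₀)))
  where
  both-flags : ∀ {f} β₀ (d : Dec (f ≡ f₀)) →
    cntL (λ ρ → ⌊ ρ ≟T (f₀ , β₀) ⌋) ((f , false) ∷ (f , true) ∷ []) ≡ bit ⌊ d ⌋
  both-flags {f} β₀ (no f≢f₀) =
    cong₂ _+_ (cong bit (does-false⁺ ((f , false) ≟T (f₀ , β₀)) λ e → f≢f₀ (cong proj₁ e)))
      (cong₂ _+_ (cong bit (does-false⁺ ((f , true) ≟T (f₀ , β₀)) λ e → f≢f₀ (cong proj₁ e))) refl)
  both-flags false (yes refl) =
    cong₂ _+_ (cong bit (does-true⁺ ((f₀ , false) ≟T (f₀ , false)) refl))
      (cong₂ _+_ (cong bit (does-false⁺ ((f₀ , true) ≟T (f₀ , false)) λ ())) refl)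
  both-flags true (yes refl) =
    cong₂ _+_ (cong bit (does-false⁺ ((f₀ , false) ≟T (f₀ , true)) λ ()))
      (cong₂ _+_ (cong bit (does-true⁺ ((f₀ , true) ≟T (f₀ , true)) refl)) refl)

sumL-allTypePairs : ∀ {n} (h : TypeRep n × TypeRep n → ℕ) →
  sumL h (allTypePairs n) ≡ sumL (λ ρ → sumL (λ σ → h (ρ , σ)) (allTypeReps n)) (allTypeReps n)
sumL-allTypePairs {n} h = trans (sumL-concatMap h (λ ρ → map (ρ ,_) R) R) (sumL-cong R (λ ρ → sumL-map h (ρ ,_) R))
  where R = allTypeReps n

module Expansion {n : ℕ} (lam : TypeRep n → TypeRep n → ℕ) where

  weight : TypeRep n × TypeRep n → ℕ
  weight x = lam (proj₁ x) (proj₂ x)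

  pairs : List (TypeRep n × TypeRep n)
  pairs = expand weight (allTypePairs n)

  R : List (TypeRep n)
  R = allTypeReps n

  marginalʳ : ∀ ρ → cntL (λ x → ⌊ proj₁ x ≟T ρ ⌋) pairs ≡ sumL (λ σ → lam ρ σ) R
  marginalʳ ρ = trans (cntL-expand (λ x → ⌊ proj₁ x ≟T ρ ⌋) weight (allTypePairs n))
    (trans (sumL-allTypePairs (λ x → if ⌊ proj₁ x ≟T ρ ⌋ then weight x else 0))
     (trans (sumL-cong R (λ ρ′ → sumL-if ⌊ ρ′ ≟T ρ ⌋ (λ σ → lam ρ′ σ) R))
            (sumL-select _≟T_ ρ (λ ρ′ → sumL (λ σ → lam ρ′ σ) R) R (allTypeReps-once n ρ))))

  marginalˢ : ∀ σ → cntL (λ x → ⌊ proj₂ x ≟T σ ⌋) pairs ≡ sumL (λ ρ → lam ρ σ) R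
  marginalˢ σ = trans (cntL-expand (λ x → ⌊ proj₂ x ≟T σ ⌋) weight (allTypePairs n))
    (trans (sumL-allTypePairs (λ x → if ⌊ proj₂ x ≟T σ ⌋ then weight x else 0))
      (sumL-cong R (λ ρ → sumL-select _≟T_ σ (λ σ′ → lam ρ σ′) R (allTypeReps-once n σ))))

label : Bool → Bool → Bool → Label
label a b c = if not a then none else if b then contains else if c then demand else none

label-contains⁻ : ∀ {a b c} → label a b c ≡ contains → a ≡ true × b ≡ true
label-contains⁻ {true} {true} _ = refl , refl
label-contains⁻ {true} {false} {true} ()
label-contains⁻ {true} {false} {false} ()
label-contains⁻ {false} ()

label-demand⁻ : ∀ {a b c} → label a b c ≡ demand → a ≡ true × b ≡ false × c ≡ true
label-demand⁻ {true} {false} {true} _ = refl , refl , refl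
label-demand⁻ {true} {true} ()
label-demand⁻ {true} {false} {false} ()
label-demand⁻ {false} ()

label-contains⁺ : ∀ {a b c} → a ≡ true → b ≡ true → label a b c ≡ contains
label-contains⁺ refl refl = refl

label-demand⁺ : ∀ {a b c} → a ≡ true → b ≡ false → c ≡ true → label a b c ≡ demand
label-demand⁺ refl refl refl = refl

label-none : ∀ {a b c} → a ≡ false → label a b c ≡ none
label-none refl = refl

label-cong : ∀ {a b c b′ c′} → (a ≡ true → b ≡ b′) → (a ≡ true → b ≡ false → c ≡ c′) →
  label a b c ≡ label a b′ c′
label-cong {false} _ _ = refl
label-cong {true} {false} b≡ c≡ rewrite sym (b≡ refl) | c≡ refl refl = refl
label-cong {true} {true}  b≡ _  rewrite sym (b≡ refl) = refl

isContains⁻ : ∀ {l} → isContains l ≡ true → l ≡ contains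
isContains⁻ {contains} _ = refl

isContains⁺ : ∀ {l} → l ≡ contains → isContains l ≡ true
isContains⁺ refl = refl

isDemand⁻ : ∀ {l} → isDemand l ≡ true → l ≡ demand
isDemand⁻ {demand} _ = refl

isDemand⁺ : ∀ {l} → l ≡ demand → isDemand l ≡ true
isDemand⁺ refl = refl

module GraphFacts {n : ℕ} (G : Graph n) where
  open Graph G

  sim⁻ : ∀ p {u v} → sim G p u v ≡ true → ∀ w → inV p w ≡ false → adj u w ≡ adj v w
  sim⁻ p e w w∉ = ==b-true⁻ (⇒b-true⁻ (allV-true⁻ _ e w) (not-true⁺ w∉))

  sim⁺ : ∀ p {u v} → (∀ w → inV p w ≡ false → adj u w ≡ adj v w) → sim G p u v ≡ true
  sim⁺ p f = allV-true⁺ _ (λ w → ⇒b-true⁺ (λ h → ==b-true⁺ (f w (not-true⁻ h))))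

  sim-refl : ∀ p u → sim G p u u ≡ true
  sim-refl p u = sim⁺ p (λ _ _ → refl)

  sim-sym : ∀ p {u v} → sim G p u v ≡ true → sim G p v u ≡ true
  sim-sym p e = sim⁺ p (λ w h → sym (sim⁻ p e w h))

  sim-trans : ∀ p {u v x} → sim G p u v ≡ true → sim G p v x ≡ true → sim G p u x ≡ true
  sim-trans p e₁ e₂ = sim⁺ p (λ w h → trans (sim⁻ p e₁ w h) (sim⁻ p e₂ w h))

  sim-mono : ∀ p q {u v} → (∀ w → inV q w ≡ false → inV p w ≡ false) →
    sim G p u v ≡ true → sim G q u v ≡ true
  sim-mono p q V̄q⊆V̄p e = sim⁺ q (λ w h → sim⁻ p e w (V̄q⊆V̄p w h))

  sim-resp : ∀ p {u v} → sim G p u v ≡ true → ∀ x → sim G p x u ≡ sim G p x v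
  sim-resp p u∼v x = bool-ext (λ e → sim-trans p e u∼v) (λ e → sim-trans p e (sim-sym p u∼v))

  HE⁺ : ∀ p o {u w} u′ → inV p u′ ≡ true → sim G p u′ u ≡ true → inV o w ≡ true →
    adj u′ w ≡ true → HE G p o u w ≡ true
  HE⁺ p o {u} {w} u′ u′∈ u′∼u w∈ u′w =
    anyV-true⁺ _ u′ (anyV-true⁺ _ w (∧-true⁺ u′∈ (∧-true⁺ u′∼u (∧-true⁺ w∈ (∧-true⁺ (sim-refl o w) u′w)))))

  HE-adj : ∀ p o {u w} → (∀ x → inV o x ≡ true → inV p x ≡ false) →
    (∀ x → inV p x ≡ true → inV o x ≡ false) →
    HE G p o u w ≡ true → inV p u ≡ true → ∀ x → sim G o x w ≡ true → adj u x ≡ true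
  HE-adj p o {u} {w} o∩p p∩o e u∈ x x∼w =
    let (u′ , h)           = anyV-true⁻ _ e
        (w′ , h′)          = anyV-true⁻ _ h
        (u′∈ , h₁)         = ∧-true⁻ {inV p u′} h′
        (u′∼u , h₂)        = ∧-true⁻ {sim G p u′ u} h₁
        (w′∈ , h₃)         = ∧-true⁻ {inV o w′} h₂
        (w′∼w , u′w′)      = ∧-true⁻ {sim G o w′ w} h₃
        uw′ : adj u w′ ≡ true
        uw′ = trans (sym (sim⁻ p u′∼u w′ (o∩p w′ w′∈))) u′w′
        w′∼x = sim-trans o w′∼w (sim-sym o x∼w)
        xu : adj x u ≡ true
        xu = trans (sym (sim⁻ o w′∼x u (p∩o u u∈))) (trans (adj-sym w′ u) uw′)
    in trans (adj-sym u x) xu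

  module ClassType {k : ℕ} {p : RTree n} (c : PartialBColoring G k p) where
    open PartialBColoring c

    Demands : Fin k → Fin n → Bool
    Demands i v = anyV (λ u → inV p u ∧ sim G p u v ∧ B u ∧
                                allV (λ w → (inV p w ∧ adj u w) ⇒b not (inC G c i w)))

    typeOf-label : ∀ i v → lookup (proj₁ (typeOf G c i)) v ≡ label (inV p v) (classMeets G c i v) (Demands i v)
    typeOf-label i v = Vecₚ.lookup∘tabulate _ v

    inC⁻ : ∀ {i v} → inC G c i v ≡ true → inV p v ≡ true × col v ≡ i
    inC⁻ {i} {v} e = let (v∈ , col≡) = ∧-true⁻ {inV p v} e in v∈ , does-true⁻ (col v ≟F i) col≡

    inC⁺ : ∀ {i v} → inV p v ≡ true → col v ≡ i → inC G c i v ≡ true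
    inC⁺ {i} {v} v∈ col≡ = ∧-true⁺ v∈ (does-true⁺ (col v ≟F i) col≡)

    meets⁻ : ∀ {i v} → classMeets G c i v ≡ true →
      Σ (Fin n) λ u → inV p u ≡ true × sim G p u v ≡ true × inC G c i u ≡ true
    meets⁻ {i} {v} e =
      let (u , h)      = anyV-true⁻ _ e
          (u∈ , h′)    = ∧-true⁻ {inV p u} h
          (u∼v , u∈C)  = ∧-true⁻ {sim G p u v} h′
      in u , u∈ , u∼v , u∈C

    meets⁺ : ∀ {i v} u → inV p u ≡ true → sim G p u v ≡ true → inC G c i u ≡ true → classMeets G c i v ≡ true
    meets⁺ u u∈ u∼v u∈C = anyV-true⁺ _ u (∧-true⁺ u∈ (∧-true⁺ u∼v u∈C))

    demands⁻ : ∀ {i v} → Demands i v ≡ true →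
      Σ (Fin n) λ u → inV p u ≡ true × sim G p u v ≡ true × B u ≡ true ×
        (∀ w → inV p w ≡ true → adj u w ≡ true → inC G c i w ≡ false)
    demands⁻ {i} {v} e =
      let (u , h)        = anyV-true⁻ _ e
          (u∈ , h₁)      = ∧-true⁻ {inV p u} h
          (u∼v , h₂)     = ∧-true⁻ {sim G p u v} h₁
          (u∈B , noNbr)  = ∧-true⁻ {B u} h₂
      in u , u∈ , u∼v , u∈B , λ w w∈ uw → not-true⁻ (⇒b-true⁻ (allV-true⁻ _ noNbr w) (∧-true⁺ w∈ uw))

    demands⁺ : ∀ {i v} u → inV p u ≡ true → sim G p u v ≡ true → B u ≡ true →
      (∀ w → inV p w ≡ true → adj u w ≡ true → inC G c i w ≡ false) → Demands i v ≡ true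
    demands⁺ u u∈ u∼v u∈B noNbr = anyV-true⁺ _ u (∧-true⁺ u∈ (∧-true⁺ u∼v (∧-true⁺ u∈B
      (allV-true⁺ _ (λ w → ⇒b-true⁺ (λ h → let (w∈ , uw) = ∧-true⁻ h in not-true⁺ (noNbr w w∈ uw)))))))

    flag⁻ : ∀ {i} → proj₂ (typeOf G c i) ≡ true → Σ (Fin n) λ u → B u ≡ true × inC G c i u ≡ true
    flag⁻ e = let (u , h) = anyV-true⁻ _ e in u , ∧-true⁻ h

    flag⁺ : ∀ {i} u → B u ≡ true → inC G c i u ≡ true → proj₂ (typeOf G c i) ≡ true
    flag⁺ u u∈B u∈C = anyV-true⁺ _ u (∧-true⁺ u∈B u∈C)

    type-contains⁻ : ∀ {i v} → lookup (proj₁ (typeOf G c i)) v ≡ contains →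
      inV p v ≡ true × classMeets G c i v ≡ true
    type-contains⁻ {i} {v} e =
      label-contains⁻ {inV p v} {classMeets G c i v} {Demands i v} (trans (sym (typeOf-label i v)) e)

    type-demand⁻ : ∀ {i v} → lookup (proj₁ (typeOf G c i)) v ≡ demand →
      inV p v ≡ true × classMeets G c i v ≡ false × Demands i v ≡ true
    type-demand⁻ {i} {v} e =
      label-demand⁻ {inV p v} {classMeets G c i v} {Demands i v} (trans (sym (typeOf-label i v)) e)

    type-contains⁺ : ∀ {i v} → inV p v ≡ true → classMeets G c i v ≡ true →
      lookup (proj₁ (typeOf G c i)) v ≡ contains
    type-contains⁺ {i} {v} v∈ meets =
      trans (typeOf-label i v) (label-contains⁺ {inV p v} {classMeets G c i v} {Demands i v} v∈ meets)

    type-demand⁺ : ∀ {i v} → inV p v ≡ true → classMeets G c i v ≡ false → Demands i v ≡ true →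
      lookup (proj₁ (typeOf G c i)) v ≡ demand
    type-demand⁺ {i} {v} v∈ ¬meets dem = trans (typeOf-label i v) (label-demand⁺ v∈ ¬meets dem)

    member-contains : ∀ {i u} → inV p u ≡ true → inC G c i u ≡ true → lookup (proj₁ (typeOf G c i)) u ≡ contains
    member-contains {u = u} u∈ u∈C = type-contains⁺ u∈ (meets⁺ u u∈ (sim-refl p u) u∈C)

    typeOf-isType : ∀ i → IsTType G p (typeOf G c i)
    typeOf-isType i =
      (λ v v∉ → trans (typeOf-label i v) (label-none {inV p v} {classMeets G c i v} {Demands i v} v∉)) ,
      (λ u v u∈ v∈ u∼v → trans (typeOf-label i u) (trans
         (cong₂ (λ a bc → label a (proj₁ bc) (proj₂ bc)) (trans u∈ (sym v∈))
           (cong₂ _,_ (anyV-cong (λ x → cong (λ z → inV p x ∧ (z ∧ inC G c i x)) (sim-resp p u∼v x)))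
                      (anyV-cong (λ x → cong (λ z → inV p x ∧ (z ∧ _)) (sim-resp p u∼v x)))))
         (sym (typeOf-label i v))))

  -- Let V_t = V_p ⊎ V_o, and let colour class m of a
  -- colouring ct of G_t agree with class ip of cp on V_p and with class io
  -- of co on V_o, with the same B on V_p.  The p-side contributions to the
  -- merge label of [v]_t are then the facts about class m seen from V_p.

  module OneSide {k : ℕ} (t r s p o : RTree n)
    (ct : PartialBColoring G k t) (cp : PartialBColoring G k p) (co : PartialBColoring G k o)
    (m ip io : Fin k)
    (p⊆t : ∀ w → inV p w ≡ true → inV t w ≡ true)
    (o⊆t : ∀ w → inV o w ≡ true → inV t w ≡ true)
    (t⊆p∪o : ∀ w → inV t w ≡ true → inV p w ≡ true ⊎ inV o w ≡ true)
    (p∩o : ∀ w → inV p w ≡ true → inV o w ≡ false)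
    (o∩p : ∀ w → inV o w ≡ true → inV p w ≡ false)
    (classᵖ : ∀ w → inV p w ≡ true → inC G ct m w ≡ inC G cp ip w)
    (classᵒ : ∀ w → inV o w ≡ true → inC G ct m w ≡ inC G co io w)
    (Bᵖ : ∀ w → inV p w ≡ true → PartialBColoring.B ct w ≡ PartialBColoring.B cp w)
    where
    module T = ClassType ct
    module P = ClassType cp
    module O = ClassType co
    fp = proj₁ (typeOf G cp ip)
    fo = proj₁ (typeOf G co io)

    ∼p⇒∼t : ∀ {u v} → sim G p u v ≡ true → sim G t u v ≡ true
    ∼p⇒∼t = sim-mono p t (λ w w∉t → ¬true⇒false (λ w∈p → true≢false (p⊆t w w∈p) w∉t))

    inCᵖ : ∀ {w} → inV p w ≡ true → inC G cp ip w ≡ true → inC G ct m w ≡ true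
    inCᵖ w∈ e = trans (classᵖ _ w∈) e

    inCᵒ : ∀ {w} → inV o w ≡ true → inC G co io w ≡ true → inC G ct m w ≡ true
    inCᵒ w∈ e = trans (classᵒ _ w∈) e

    containsFrom : Fin n → Bool
    containsFrom v = anyV (λ u → inV p u ∧ sim G t u v ∧ isContains (lookup fp u))

    containsFrom⇒meets : ∀ v → containsFrom v ≡ true → classMeets G ct m v ≡ true
    containsFrom⇒meets v e =
      let (u , h)            = anyV-true⁻ _ e
          (u∈ , h′)          = ∧-true⁻ {inV p u} h
          (u∼v , contains-u) = ∧-true⁻ {sim G t u v} h′
          (_ , meets-u)      = P.type-contains⁻ (isContains⁻ contains-u)
          (x , x∈ , x∼u , x∈C) = P.meets⁻ meets-u
      in T.meets⁺ x (p⊆t x x∈) (sim-trans t (∼p⇒∼t x∼u) u∼v) (inCᵖ x∈ x∈C)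

    meets⇒containsFrom : ∀ v u → inV p u ≡ true → sim G t u v ≡ true → inC G ct m u ≡ true →
      containsFrom v ≡ true
    meets⇒containsFrom v u u∈ u∼v u∈C =
      anyV-true⁺ _ u (∧-true⁺ u∈ (∧-true⁺ u∼v (isContains⁺ (P.member-contains u∈ (trans (sym (classᵖ u u∈)) u∈C)))))

    demandFrom⇒demands : ∀ v → demandSide G t r s p o fp fo v ≡ true → T.Demands m v ≡ true
    demandFrom⇒demands v e =
      let (u , h)          = anyV-true⁻ _ e
          (u∈ , h₁)        = ∧-true⁻ {inV p u} h
          (u∼v , h₂)       = ∧-true⁻ {sim G t u v} h₁
          (dem-u , noC)    = ∧-true⁻ {isDemand (lookup fp u)} h₂
          (_ , _ , dems)   = P.type-demand⁻ (isDemand⁻ dem-u)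
          (u′ , u′∈ , u′∼u , u′∈B , noNbr) = P.demands⁻ dems
          noNbrᵗ : ∀ w → inV t w ≡ true → adj u′ w ≡ true → inC G ct m w ≡ false
          noNbrᵗ w w∈ u′w = [ (λ w∈p → trans (classᵖ w w∈p) (noNbr w w∈p u′w))
                            , (λ w∈o → trans (classᵒ w w∈o) (¬true⇒false λ w∈C →
                                 true≢false (isContains⁺ (O.member-contains w∈o w∈C))
                                   (not-true⁻ (⇒b-true⁻ (allV-true⁻ _ noC w)
                                     (∧-true⁺ w∈o (HE⁺ p o u′ u′∈ u′∼u w∈o u′w)))))) ]′ (t⊆p∪o w w∈)
      in T.demands⁺ u′ (p⊆t u′ u′∈) (sim-trans t (∼p⇒∼t u′∼u) u∼v) (trans (Bᵖ u′ u′∈) u′∈B) noNbrᵗ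

    demands⇒demandFrom : ∀ v → classMeets G ct m v ≡ false → ∀ u → inV p u ≡ true → sim G t u v ≡ true →
      PartialBColoring.B ct u ≡ true → (∀ w → inV t w ≡ true → adj u w ≡ true → inC G ct m w ≡ false) →
      demandSide G t r s p o fp fo v ≡ true
    demands⇒demandFrom v ¬meets u u∈ u∼v u∈B noNbr =
      anyV-true⁺ _ u (∧-true⁺ u∈ (∧-true⁺ u∼v (∧-true⁺ (isDemand⁺ demand-u) noContainsNbr)))
      where
      ¬meetsᵖ : classMeets G cp ip u ≡ false
      ¬meetsᵖ = ¬true⇒false λ e → let (x , x∈ , x∼u , x∈C) = P.meets⁻ e in
        true≢false (T.meets⁺ x (p⊆t x x∈) (sim-trans t (∼p⇒∼t x∼u) u∼v) (inCᵖ x∈ x∈C)) ¬meets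
      demand-u : lookup fp u ≡ demand
      demand-u = P.type-demand⁺ u∈ ¬meetsᵖ (P.demands⁺ u u∈ (sim-refl p u) (trans (sym (Bᵖ u u∈)) u∈B)
        (λ w w∈ uw → trans (sym (classᵖ w w∈)) (noNbr w (p⊆t w w∈) uw)))
      noContainsNbr = allV-true⁺ _ (λ w → ⇒b-true⁺ λ h →
        let (w∈ , uw) = ∧-true⁻ {inV o w} h in
        not-true⁺ (¬true⇒false λ contains-w →
          let (_ , meets-w)         = O.type-contains⁻ (isContains⁻ contains-w)
              (x , x∈ , x∼w , x∈C)  = O.meets⁻ meets-w
          in true≢false (inCᵒ x∈ x∈C) (noNbr x (o⊆t x x∈) (HE-adj p o o∩p p∩o uw u∈ x x∼w))))

    -- A B-vertex v ∈ V_p cannot witness invalidity of class m: either class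
    -- ip of cp is invalid, or the o-neighbour met by the demand of [v]_p is
    -- a neighbour of v in class m.
    valid-side : Valid G cp → ∀ v → DemandsMet G t r s p o fp fo v → inV p v ≡ true →
      PartialBColoring.B ct v ≡ true → inC G ct m v ≡ false →
      (∀ w → inC G ct m w ≡ true → adj v w ≡ false) → ⊥
    valid-side valid-p v met v∈ v∈B v∉C noNbr with classMeets G cp ip v in meetsᵖ
    ... | true  = valid-p ip (v , v∈ , trans (sym (Bᵖ v v∈)) v∈B , meetsᵖ , trans (sym (classᵖ v v∈)) v∉C ,
                    λ w w∈C → noNbr w (inCᵖ (proj₁ (P.inC⁻ w∈C)) w∈C))
    ... | false =
      let demand-v = P.type-demand⁺ v∈ meetsᵖ (P.demands⁺ v v∈ (sim-refl p v) (trans (sym (Bᵖ v v∈)) v∈B)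
                       (λ w w∈ vw → ¬true⇒false λ w∈C → true≢false vw (noNbr w (inCᵖ w∈ w∈C))))
          (w , w∈ , vw , contains-w) = met v v∈ (sim-refl t v) demand-v
          (_ , meets-w)              = O.type-contains⁻ contains-w
          (x , x∈ , x∼w , x∈C)       = O.meets⁻ meets-w
      in true≢false (HE-adj p o o∩p p∩o vw v∈ x x∼w) (noNbr x (inCᵒ x∈ x∈C))

  module Merge (r s : RTree n)
    (r∩s : ∀ v → inV r v ≡ true → inV s v ≡ false)
    {k : ℕ} (cr : PartialBColoring G k r) (cs : PartialBColoring G k s)
    (πr πs : Permutation k k)
    (compatible : ∀ m → Compatible G (node (r ∷ s ∷ [])) r s (typeOf G cr (πr ⟨$⟩ʳ m)) (typeOf G cs (πs ⟨$⟩ʳ m)))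
    where
    module R = PartialBColoring cr
    module S = PartialBColoring cs
    module CR = ClassType cr
    module CS = ClassType cs

    t : RTree n
    t = node (r ∷ s ∷ [])

    r⊆t : ∀ v → inV r v ≡ true → inV t v ≡ true
    r⊆t v e = trans (inV-binary r s v) (∨-trueˡ e)

    s⊆t : ∀ v → inV s v ≡ true → inV t v ≡ true
    s⊆t v e = trans (inV-binary r s v) (∨-trueʳ {inV r v} e)

    s∩r : ∀ v → inV s v ≡ true → inV r v ≡ false
    s∩r v e = ¬true⇒false (λ h → true≢false e (r∩s v h))

    t⊆r∪s : ∀ v → inV t v ≡ true → inV r v ≡ true ⊎ inV s v ≡ true
    t⊆r∪s v e = ∨-true⁻ (trans (sym (inV-binary r s v)) e)

    t⊆s∪r : ∀ v → inV t v ≡ true → inV s v ≡ true ⊎ inV r v ≡ true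
    t⊆s∪r v e = [ inj₂ , inj₁ ]′ (t⊆r∪s v e)

    colour : Fin n → Fin k
    colour v = if inV r v then πr ⟨$⟩ˡ R.col v else πs ⟨$⟩ˡ S.col v

    inB : Fin n → Bool
    inB v = if inV r v then R.B v else S.B v

    colourʳ : ∀ {v} → inV r v ≡ true → R.col v ≡ πr ⟨$⟩ʳ colour v
    colourʳ e = trans (sym (inverseʳ πr)) (cong (πr ⟨$⟩ʳ_) (sym (if-true e)))

    colourˢ : ∀ {v} → inV s v ≡ true → S.col v ≡ πs ⟨$⟩ʳ colour v
    colourˢ {v} e = trans (sym (inverseʳ πs)) (cong (πs ⟨$⟩ʳ_) (sym (if-false (s∩r v e))))

    inBʳ : ∀ v → inV r v ≡ true → inB v ≡ R.B v
    inBʳ v e = if-true e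

    inBˢ : ∀ v → inV s v ≡ true → inB v ≡ S.B v
    inBˢ v e = if-false (s∩r v e)

    sameʳ : ∀ {u v} → inV r u ≡ true → inV r v ≡ true → colour u ≡ colour v → R.col u ≡ R.col v
    sameʳ u∈ v∈ eq = trans (colourʳ u∈) (trans (cong (πr ⟨$⟩ʳ_) eq) (sym (colourʳ v∈)))

    sameˢ : ∀ {u v} → inV s u ≡ true → inV s v ≡ true → colour u ≡ colour v → S.col u ≡ S.col v
    sameˢ u∈ v∈ eq = trans (colourˢ u∈) (trans (cong (πs ⟨$⟩ʳ_) eq) (sym (colourˢ v∈)))

    classʳ : ∀ {u} → inV r u ≡ true → inC G cr (πr ⟨$⟩ʳ colour u) u ≡ true
    classʳ u∈ = CR.inC⁺ u∈ (colourʳ u∈)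

    classˢ : ∀ {u v} → inV s v ≡ true → colour u ≡ colour v → inC G cs (πs ⟨$⟩ʳ colour u) v ≡ true
    classˢ v∈ eq = CS.inC⁺ v∈ (trans (colourˢ v∈) (cong (πs ⟨$⟩ʳ_) (sym eq)))

    -- compatibility (2): no edge between two contains-classes
    cross-proper : ∀ u v → inV r u ≡ true → inV s v ≡ true → adj u v ≡ true → colour u ≡ colour v → ⊥
    cross-proper u v u∈ v∈ uv eq =
      proj₁ (proj₂ (compatible (colour u))) u v u∈ v∈ (HE⁺ r s u u∈ (sim-refl r u) v∈ uv)
        (CR.member-contains u∈ (classʳ u∈)) (CS.member-contains v∈ (classˢ v∈ eq))

    proper : ∀ u v → inV t u ≡ true → inV t v ≡ true → adj u v ≡ true → colour u ≢ colour v
    proper u v u∈ v∈ uv eq with t⊆r∪s u u∈ | t⊆r∪s v v∈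
    ... | inj₁ u∈r | inj₁ v∈r = R.proper u v u∈r v∈r uv (sameʳ u∈r v∈r eq)
    ... | inj₂ u∈s | inj₂ v∈s = S.proper u v u∈s v∈s uv (sameˢ u∈s v∈s eq)
    ... | inj₁ u∈r | inj₂ v∈s = cross-proper u v u∈r v∈s uv eq
    ... | inj₂ u∈s | inj₁ v∈r = cross-proper v u v∈r u∈s (trans (adj-sym v u) uv) (sym eq)

    B⊆V : ∀ v → inB v ≡ true → inV t v ≡ true
    B⊆V v e with inV r v in v∈r
    ... | true  = r⊆t v v∈r
    ... | false = s⊆t v (S.B⊆V v e)

    -- compatibility (1): two classes with flag β = 1 are never merged
    cross-B : ∀ u v → inV r u ≡ true → inV s v ≡ true → R.B u ≡ true → S.B v ≡ true →
      colour u ≡ colour v → ⊥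
    cross-B u v u∈ v∈ u∈B v∈B eq = two-flags (CR.flag⁺ u u∈B (classʳ u∈)) (CS.flag⁺ v v∈B (classˢ v∈ eq))
      (proj₁ (compatible (colour u)))
      where
      two-flags : ∀ {a b} → a ≡ true → b ≡ true → bit a + bit b ≤ 1 → ⊥
      two-flags refl refl (s≤s ())

    B-once : ∀ u v → inB u ≡ true → inB v ≡ true → colour u ≡ colour v → u ≡ v
    B-once u v u∈B v∈B eq with t⊆r∪s u (B⊆V u u∈B) | t⊆r∪s v (B⊆V v v∈B)
    ... | inj₁ u∈ | inj₁ v∈ = R.B-once u v (trans (sym (inBʳ u u∈)) u∈B) (trans (sym (inBʳ v v∈)) v∈B) (sameʳ u∈ v∈ eq)
    ... | inj₂ u∈ | inj₂ v∈ = S.B-once u v (trans (sym (inBˢ u u∈)) u∈B) (trans (sym (inBˢ v v∈)) v∈B) (sameˢ u∈ v∈ eq)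
    ... | inj₁ u∈ | inj₂ v∈ = ⊥-elim (cross-B u v u∈ v∈ (trans (sym (inBʳ u u∈)) u∈B) (trans (sym (inBˢ v v∈)) v∈B) eq)
    ... | inj₂ u∈ | inj₁ v∈ = ⊥-elim (cross-B v u v∈ u∈ (trans (sym (inBʳ v v∈)) v∈B) (trans (sym (inBˢ u u∈)) u∈B) (sym eq))

    merged : PartialBColoring G k t
    merged = record { col = colour ; B = inB ; proper = proper ; B⊆V = B⊆V ; B-once = B-once }

    module CT = ClassType merged

    restrictʳ : ∀ m w → inV r w ≡ true → inC G merged m w ≡ inC G cr (πr ⟨$⟩ʳ m) w
    restrictʳ m w w∈ = bool-ext
      (λ e → CR.inC⁺ w∈ (trans (colourʳ w∈) (cong (πr ⟨$⟩ʳ_) (proj₂ (CT.inC⁻ e)))))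
      (λ e → CT.inC⁺ (r⊆t w w∈) (trans (if-true w∈) (trans (cong (πr ⟨$⟩ˡ_) (proj₂ (CR.inC⁻ e))) (inverseˡ πr))))

    restrictˢ : ∀ m w → inV s w ≡ true → inC G merged m w ≡ inC G cs (πs ⟨$⟩ʳ m) w
    restrictˢ m w w∈ = bool-ext
      (λ e → CS.inC⁺ w∈ (trans (colourˢ w∈) (cong (πs ⟨$⟩ʳ_) (proj₂ (CT.inC⁻ e)))))
      (λ e → CT.inC⁺ (s⊆t w w∈) (trans (if-false (s∩r w w∈)) (trans (cong (πs ⟨$⟩ˡ_) (proj₂ (CS.inC⁻ e))) (inverseˡ πs))))

    module SideR (m : Fin k) =
      OneSide t r s r s merged cr cs m (πr ⟨$⟩ʳ m) (πs ⟨$⟩ʳ m) r⊆t s⊆t t⊆r∪s r∩s s∩r (restrictʳ m) (restrictˢ m) inBʳ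
    module SideS (m : Fin k) =
      OneSide t r s s r merged cs cr m (πs ⟨$⟩ʳ m) (πr ⟨$⟩ʳ m) s⊆t r⊆t t⊆s∪r s∩r r∩s (restrictˢ m) (restrictʳ m) inBˢ

    meets≡containsIn : ∀ m v → classMeets G merged m v ≡ SideR.containsFrom m v ∨ SideS.containsFrom m v
    meets≡containsIn m v = bool-ext
      (λ e → let (u , u∈ , u∼v , u∈C) = CT.meets⁻ e in
         [ (λ u∈r → ∨-trueˡ (SideR.meets⇒containsFrom m v u u∈r u∼v u∈C))
         , (λ u∈s → ∨-trueʳ {SideR.containsFrom m v} (SideS.meets⇒containsFrom m v u u∈s u∼v u∈C)) ]′ (t⊆r∪s u u∈))
      (λ e → [ SideR.containsFrom⇒meets m v , SideS.containsFrom⇒meets m v ]′ (∨-true⁻ e))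

    demands≡demandSide : ∀ m v → classMeets G merged m v ≡ false →
      CT.Demands m v ≡ demandSide G t r s r s (SideR.fp m) (SideR.fo m) v ∨ demandSide G t r s s r (SideS.fp m) (SideS.fo m) v
    demands≡demandSide m v ¬meets = bool-ext
      (λ e → let (u , u∈ , u∼v , u∈B , noNbr) = CT.demands⁻ e in
         [ (λ u∈r → ∨-trueˡ (SideR.demands⇒demandFrom m v ¬meets u u∈r u∼v u∈B noNbr))
         , (λ u∈s → ∨-trueʳ {demandSide G t r s r s (SideR.fp m) (SideR.fo m) v}
                      (SideS.demands⇒demandFrom m v ¬meets u u∈s u∼v u∈B noNbr)) ]′ (t⊆r∪s u u∈))
      (λ e → [ SideR.demandFrom⇒demands m v , SideS.demandFrom⇒demands m v ]′ (∨-true⁻ e))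

    flag≡ : ∀ m → proj₂ (typeOf G merged m) ≡ proj₂ (typeOf G cr (πr ⟨$⟩ʳ m)) ∨ proj₂ (typeOf G cs (πs ⟨$⟩ʳ m))
    flag≡ m = bool-ext
      (λ e → let (u , u∈B , u∈C) = CT.flag⁻ e in
         [ (λ u∈ → ∨-trueˡ (CR.flag⁺ u (trans (sym (inBʳ u u∈)) u∈B) (trans (sym (restrictʳ m u u∈)) u∈C)))
         , (λ u∈ → ∨-trueʳ {proj₂ (typeOf G cr (πr ⟨$⟩ʳ m))}
                     (CS.flag⁺ u (trans (sym (inBˢ u u∈)) u∈B) (trans (sym (restrictˢ m u u∈)) u∈C))) ]′
         (t⊆r∪s u (proj₁ (CT.inC⁻ u∈C))))
      (λ e → [ (λ h → let (u , u∈B , u∈C) = CR.flag⁻ h ; u∈ = proj₁ (CR.inC⁻ u∈C) in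
                  CT.flag⁺ u (trans (inBʳ u u∈) u∈B) (trans (restrictʳ m u u∈) u∈C))
             , (λ h → let (u , u∈B , u∈C) = CS.flag⁻ h ; u∈ = proj₁ (CS.inC⁻ u∈C) in
                  CT.flag⁺ u (trans (inBˢ u u∈) u∈B) (trans (restrictˢ m u u∈) u∈C)) ]′ (∨-true⁻ e))

    merged-type : ∀ m → typeOf G merged m ≡ mergeType G t r s (typeOf G cr (πr ⟨$⟩ʳ m)) (typeOf G cs (πs ⟨$⟩ʳ m))
    merged-type m = cong₂ _,_ (Vecₚ.tabulate-cong λ v →
      label-cong {inV t v} (λ _ → meets≡containsIn m v) (λ _ ¬meets → demands≡demandSide m v ¬meets)) (flag≡ m)

    -- compatibility (3) + validity of both sides gives validity of the merge
    merged-valid : Valid G cr → Valid G cs → Valid G merged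
    merged-valid valid-r valid-s m (v , v∈ , v∈B , meets , v∉C , noNbr) with t⊆r∪s v v∈
    ... | inj₁ v∈r = SideR.valid-side m valid-r v (proj₁ demandsMet) v∈r v∈B v∉C noNbr
      where demandsMet = proj₂ (proj₂ (compatible m)) v v∈ (trans (sym (meets≡containsIn m v)) meets)
    ... | inj₂ v∈s = SideS.valid-side m valid-s v (proj₂ demandsMet) v∈s v∈B v∉C noNbr
      where demandsMet = proj₂ (proj₂ (compatible m)) v v∈ (trans (sym (meets≡containsIn m v)) meets)

isType? : ∀ {n} (G : Graph n) p τ → Dec (IsTType G p τ)
isType? G p (f , β) =
  all? (λ v → (inV p v ≟B false) →-dec (lookup f v ≟L none)) ×-dec
  all? (λ u → all? (λ v → (inV p u ≟B true) →-dec ((inV p v ≟B true) →-dec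
    ((sim G p u v ≟B true) →-dec (lookup f u ≟L lookup f v)))))

agree-with-signature : ∀ {n} {G : Graph n} {k p γ} (f : TypeRep n → ℕ) → IsSignature G k p γ →
  (∀ ρ → IsTType G p ρ → f ρ ≡ γ ρ) → (∀ ρ → ¬ IsTType G p ρ → f ρ ≡ 0) → ∀ ρ → f ρ ≡ γ ρ
agree-with-signature {G = G} {p = p} f sig onTypes offTypes ρ with isType? G p ρ
... | yes T = onTypes ρ T
... | no ¬T = trans (offTypes ρ ¬T) (sym (proj₁ sig ρ ¬T))

sumL-vanishes : ∀ {A : Set} (f : A → ℕ) L → (∀ x → f x ≡ 0) → sumL f L ≡ 0
sumL-vanishes f L f≡0 = trans (sumL-cong L f≡0) (sumL-zero L)

weight-vanishes : ∀ (m : ℕ) {P : Set} → (m ≢ 0 → P) → ¬ P → m ≡ 0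
weight-vanishes m pos ¬P with m ℕ.≟ 0
... | yes m≡0 = m≡0
... | no  m≢0 = ⊥-elim (¬P (pos m≢0))

module Combine {n : ℕ} (G : Graph n) {k : ℕ} (r s : RTree n) {γt γr γs : TypeRep n → ℕ}
  (triple : CompatibleTriple G (node (r ∷ s ∷ [])) r s k γt γr γs)
  where
  t : RTree n
  t = node (r ∷ s ∷ [])

  lam : TypeRep n → TypeRep n → ℕ
  lam = proj₁ triple

  support : ∀ ρ σ → lam ρ σ ≢ 0 → IsTType G r ρ × IsTType G s σ × Compatible G t r s ρ σ
  support = proj₁ (proj₂ triple)

  rowSums : ∀ ρ → IsTType G r ρ → sumL (λ σ → lam ρ σ) (allTypeReps n) ≡ γr ρ
  rowSums = proj₁ (proj₂ (proj₂ (proj₂ triple)))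

  colSums : ∀ σ → IsTType G s σ → sumL (λ ρ → lam ρ σ) (allTypeReps n) ≡ γs σ
  colSums = proj₁ (proj₂ (proj₂ (proj₂ (proj₂ triple))))

  mergeSums : ∀ τ → IsTType G t τ →
    sumL (λ x → if ⌊ mergeType G t r s (proj₁ x) (proj₂ x) ≟T τ ⌋ then lam (proj₁ x) (proj₂ x) else 0)
         (allTypePairs n) ≡ γt τ
  mergeSums = proj₂ (proj₂ (proj₂ (proj₂ (proj₂ triple))))

  open Expansion lam
  open Alignment (_≟T_ {n})

  row-sums : IsSignature G k r γr → ∀ ρ → sumL (λ σ → lam ρ σ) R ≡ γr ρ
  row-sums sig = agree-with-signature {G = G} {p = r} _ sig rowSums λ ρ ¬T →
    sumL-vanishes _ R λ σ → weight-vanishes (lam ρ σ) (λ nz → proj₁ (support ρ σ nz)) ¬T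

  col-sums : IsSignature G k s γs → ∀ σ → sumL (λ ρ → lam ρ σ) R ≡ γs σ
  col-sums sig = agree-with-signature {G = G} {p = s} _ sig colSums λ σ ¬T →
    sumL-vanishes _ R λ ρ → weight-vanishes (lam ρ σ) (λ nz → proj₁ (proj₂ (support ρ σ nz))) ¬T

  mult≡signature : ∀ {p γ} (c : PartialBColoring G k p) → HasSignature G c γ → ∀ τ → mult (typeOf G c) τ ≡ γ τ
  mult≡signature c sig τ = trans (sym (countF≡cnt (λ i → ⌊ typeOf G c i ≟T τ ⌋))) (sig τ)

  balancedʳ : IsSignature G k r γr → (cr : PartialBColoring G k r) → HasSignature G cr γr →
    Balanced proj₁ pairs (typeOf G cr)
  balancedʳ sig cr hsig τ = trans (mult≡signature cr hsig τ) (sym (trans (marginalʳ τ) (row-sums sig τ)))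

  balancedˢ : IsSignature G k s γs → (cs : PartialBColoring G k s) → HasSignature G cs γs →
    Balanced proj₂ pairs (typeOf G cs)
  balancedˢ sig cs hsig τ = trans (mult≡signature cs hsig τ) (sym (trans (marginalˢ τ) (col-sums sig τ)))

  align-colourings : IsSignature G k r γr → IsSignature G k s γs →
    (cr : PartialBColoring G k r) → HasSignature G cr γr →
    (cs : PartialBColoring G k s) → HasSignature G cs γs →
    Aligned pairs (typeOf G cr) (typeOf G cs)
  align-colourings sigR sigS cr hr cs hs =
    align pairs (typeOf G cr) (typeOf G cs) (balancedʳ sigR cr hr) (balancedˢ sigS cs hs)

  CompatiblePair : TypeRep n × TypeRep n → Set
  CompatiblePair x = IsTType G r (proj₁ x) × IsTType G s (proj₂ x) × Compatible G t r s (proj₁ x) (proj₂ x)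

  pairs-compatible : All CompatiblePair pairs
  pairs-compatible = All-expand weight (allTypePairs n) (λ x nz → support (proj₁ x) (proj₂ x) nz)

  module Merged (r∩s : ∀ v → inV r v ≡ true → inV s v ≡ false)
    (cr : PartialBColoring G k r) (cs : PartialBColoring G k s)
    (aligned : Aligned pairs (typeOf G cr) (typeOf G cs))
    where
    open Aligned aligned

    compatible : ∀ m → Compatible G t r s (typeOf G cr (πr ⟨$⟩ʳ m)) (typeOf G cs (πs ⟨$⟩ʳ m))
    compatible m = subst₂ (Compatible G t r s) (sym (alignedʳ m)) (sym (alignedˢ m))
      (proj₂ (proj₂ (pair-all pairs-compatible m)))

    open GraphFacts.Merge G r s r∩s cr cs πr πs compatible public
      using (merged; merged-valid; merged-type)

    merges-to : TypeRep n → TypeRep n × TypeRep n → Bool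
    merges-to τ x = ⌊ mergeType G t r s (proj₁ x) (proj₂ x) ≟T τ ⌋

    merged-count : ∀ τ → cnt (λ m → ⌊ typeOf G merged m ≟T τ ⌋) ≡ sumL (λ x → if merges-to τ x then weight x else 0) (allTypePairs n)
    merged-count τ = trans (cnt-cong λ m → cong (λ z → ⌊ z ≟T τ ⌋)
                             (trans (merged-type m) (cong₂ (mergeType G t r s) (alignedʳ m) (alignedˢ m))))
                       (trans (pair-cnt (merges-to τ)) (cntL-expand (merges-to τ) weight (allTypePairs n)))

    merged-signature : IsSignature G k t γt → HasSignature G merged γt
    merged-signature sig τ = trans (countF≡cnt (λ m → ⌊ typeOf G merged m ≟T τ ⌋)) (agree τ)
      where
      agree : ∀ τ → cnt (λ m → ⌊ typeOf G merged m ≟T τ ⌋) ≡ γt τ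
      agree = agree-with-signature {G = G} {p = t} _ sig (λ τ T → trans (merged-count τ) (mergeSums τ T))
        (λ τ ¬T → trans (cnt-cong λ m → does-false⁺ (typeOf G merged m ≟T τ)
                           (λ e → ¬T (subst (IsTType G t) e (GraphFacts.ClassType.typeOf-isType G {k} {t} merged m))))
                        (cnt-false {k}))

mainTheorem8 : ∀ {n : ℕ} (G : Graph n) (D : RootedBranchDecomposition n)
    (k : ℕ) → 1 ≤ k →
    (t r s : RTree n) → t ≼ RootedBranchDecomposition.tree D →
    t ≡ node (r ∷ s ∷ []) →
    (γt γr γs : TypeRep n → ℕ) →
    IsSignature G k t γt → IsSignature G k r γr → IsSignature G k s γs →
    CompatibleTriple G t r s k γt γr γs →
    Σ (PartialBColoring G k r) (λ c → Valid G c × HasSignature G c γr) →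
    Σ (PartialBColoring G k s) (λ c → Valid G c × HasSignature G c γs) →
    Σ (PartialBColoring G k t) (λ c → Valid G c × HasSignature G c γt)
mainTheorem8 G D k _ t r s t≼T refl γt γr γs sigT sigR sigS triple (cr , valid-r , sig-r) (cs , valid-s , sig-s) =
  merged , merged-valid valid-r valid-s , merged-signature sigT
  where
  open Combine G r s triple using (align-colourings; module Merged)
  r∩s : ∀ v → inV r v ≡ true → inV s v ≡ false
  r∩s = children-disjoint r s (unique-subtree t≼T (RootedBranchDecomposition.leaves-unique D))
  open Merged r∩s cr cs (align-colourings sigR sigS cr sig-r cs sig-s)
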